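{- For any digraph $G$, the quotient digraph $G/S$ is thin.
   Context: All digraphs are finite and simple without loops: a digraph $G=(V,E)$ has $E\subseteq\{(x,y)\in V\times V: x\neq y\}$; edges $(x,y)$ are written $xy$. The closed out-neighborhood of $v$ is $N^+[v]=\{x: vx\in E\}\cup\{v\}$ and the closed in-neighborhood is $N^-[v]=\{x: xv\in E\}\cup\{v\}$. The equivalence relation $S$ on $V$ is defined by $x\sim_S y$ iff $N^+[x]=N^+[y]$ and $N^-[x]=N^-[y]$. The quotient $G/S$ has as vertices the equivalence classes of $S$, and for distinct classes $a,b$ there is an edge $ab$ iff $xy\in E$ for some $x\in a$, $y\in b$. A digraph is thin if for all distinct vertices $x,y$ we have $N^+[x]\neq N^+[y]$ or $N^-[x]\neq N^-[y]$ (with neighborhoods taken in that digraph). -}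

module Defs where

open import Data.Nat using (ℕ)
open import Data.Fin using (Fin)
open import Data.Bool using (Bool; true; false)
open import Data.Product using (_×_; ∃-syntax)
open import Data.Sum using (_⊎_)
open import Relation.Binary.PropositionalEquality using (_≡_)
open import Relation.Nullary using (¬_)
open import Relation.Unary using (Pred; _≐_)
open import Level using (0ℓ)

record Digraph : Set where
  field
    n       : ℕ
    adj     : Fin n → Fin n → Bool
    noLoops : ∀ x → adj x x ≡ false

-- Generic notions for a "digraph presented on a setoid": vertices of type V,
-- vertex equality _≈_ (≡ for an ordinary digraph, the equivalence S for a
-- quotient whose classes are represented by their members), edge relation E.
module Nbhd {V : Set} (_≈_ : V → V → Set) (E : V → V → Set) where
  N⁺ : V → Pred V 0ℓ
  N⁺ v x = E v x ⊎ x ≈ v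
  N⁻ : V → Pred V 0ℓ
  N⁻ v x = E x v ⊎ x ≈ v
  IsThin : Set
  IsThin = ∀ x y → ¬ (x ≈ y) → ¬ ((N⁺ x ≐ N⁺ y) × (N⁻ x ≐ N⁻ y))

module _ (G : Digraph) where
  open Digraph G

  Edge : Fin n → Fin n → Set
  Edge x y = adj x y ≡ true

  open Nbhd {Fin n} _≡_ Edge renaming (N⁺ to N⁺G; N⁻ to N⁻G)

  _∼S_ : Fin n → Fin n → Set
  x ∼S y = (N⁺G x ≐ N⁺G y) × (N⁻G x ≐ N⁻G y)

  -- edges of G/S, with classes represented by their members:
  -- for distinct classes [a],[b], [a][b] is an edge iff x y ∈ E for some
  -- x ∈ [a], y ∈ [b].
  QEdge : Fin n → Fin n → Set
  QEdge a b = ¬ (a ∼S b) × ∃[ x ] ∃[ y ] (x ∼S a × y ∼S b × Edge x y)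

  QuotientThin : Set
  QuotientThin = Nbhd.IsThin _∼S_ QEdge

-- Equivalent vertices have the same neighbours, so an edge of G/S between the
-- classes of x and y is just an edge x y of G with x and y inequivalent. Hence a
-- vertex lies in a closed neighbourhood of x in G exactly when (up to double
-- negation) its class lies in the corresponding neighbourhood of the class of x
-- in G/S. Neighbourhoods in G are decidable, so equal neighbourhoods in G/S give
-- equal neighbourhoods in G, that is, equal classes.
module Submission where

open import Defs
open import Data.Fin using (Fin)
open import Data.Fin.Properties using (_≟_)
open import Data.Bool.Properties using () renaming (_≟_ to _≟ᵇ_)
open import Data.Product using (_,_; proj₁; proj₂)
open import Data.Sum using (inj₁; inj₂)
open import Function using (_∘_)
open import Level using (0ℓ)
open import Relation.Binary.PropositionalEquality using (_≡_; refl)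
open import Relation.Nullary using (¬_; contradiction)
open import Relation.Nullary.Decidable using (decidable-stable; _⊎-dec_)
open import Relation.Nullary.Negation using (¬¬-map)
open import Relation.Unary using (Pred; Decidable; _⊆_; _≐_)
open import Relation.Unary.Properties using (≐-refl; ≐-sym)

module _ {A : Set} {P Q : A → Pred A 0ℓ}
         (Q⊆P : ∀ v → Q v ⊆ P v)
         (P⊆¬¬Q : ∀ v {x} → P v x → ¬ ¬ Q v x)
         (P? : ∀ v → Decidable (P v)) where

  ⊆-reflect : ∀ {a b} → Q a ⊆ Q b → P a ⊆ P b
  ⊆-reflect {a} {b} Qa⊆Qb {x} =
    decidable-stable (P? b x) ∘ ¬¬-map (Q⊆P b ∘ Qa⊆Qb) ∘ P⊆¬¬Q a

  ≐-reflect : ∀ {a b} → Q a ≐ Q b → P a ≐ P b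
  ≐-reflect (Qa⊆Qb , Qb⊆Qa) = ⊆-reflect Qa⊆Qb , ⊆-reflect Qb⊆Qa

module _ (G : Digraph) where
  open Digraph G
  open Nbhd {Fin n} _≡_ (Edge G) using () renaming (N⁺ to N⁺G; N⁻ to N⁻G)
  open Nbhd {Fin n} (_∼S_ G) (QEdge G) using () renaming (N⁺ to N⁺Q; N⁻ to N⁻Q)

  private
    _∼_ = _∼S_ G

  ∼S-refl : ∀ {x} → x ∼ x
  ∼S-refl = ≐-refl , ≐-refl

  ∼S-sym : ∀ {x y} → x ∼ y → y ∼ x
  ∼S-sym (N⁺≐ , N⁻≐) = ≐-sym N⁺≐ , ≐-sym N⁻≐

  ∼S⇒∈N⁺ : ∀ {x v} → x ∼ v → N⁺G v x
  ∼S⇒∈N⁺ ((N⁺x⊆N⁺v , _) , _) = N⁺x⊆N⁺v (inj₂ refl)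

  ∼S⇒∈N⁻ : ∀ {x v} → x ∼ v → N⁻G v x
  ∼S⇒∈N⁻ (_ , (N⁻x⊆N⁻v , _)) = N⁻x⊆N⁻v (inj₂ refl)

  QEdge⇒Edge : ∀ {u v} → QEdge G u v → Edge G u v
  QEdge⇒Edge {u} {v} (u≁v , x , y , x∼u , y∼v , xy)
    with proj₁ (proj₁ x∼u) (inj₁ xy)
  ... | inj₂ refl = contradiction y∼v u≁v
  ... | inj₁ uy with proj₁ (proj₂ y∼v) (inj₁ uy)
  ...   | inj₁ uv   = uv
  ...   | inj₂ refl = contradiction ∼S-refl u≁v

  N⁺Q⊆N⁺G : ∀ v → N⁺Q v ⊆ N⁺G v
  N⁺Q⊆N⁺G v (inj₁ vx)  = inj₁ (QEdge⇒Edge vx)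
  N⁺Q⊆N⁺G v (inj₂ x∼v) = ∼S⇒∈N⁺ x∼v

  N⁻Q⊆N⁻G : ∀ v → N⁻Q v ⊆ N⁻G v
  N⁻Q⊆N⁻G v (inj₁ xv)  = inj₁ (QEdge⇒Edge xv)
  N⁻Q⊆N⁻G v (inj₂ x∼v) = ∼S⇒∈N⁻ x∼v

  -- If x ∼ v the class of x is the class of v; otherwise the edge lifts to G/S.
  N⁺G⊆¬¬N⁺Q : ∀ v {x} → N⁺G v x → ¬ ¬ N⁺Q v x
  N⁺G⊆¬¬N⁺Q v (inj₂ refl) ∉ = ∉ (inj₂ ∼S-refl)
  N⁺G⊆¬¬N⁺Q v {x} (inj₁ vx) ∉ =
    ∉ (inj₁ ((λ v∼x → ∉ (inj₂ (∼S-sym v∼x))) , v , x , ∼S-refl , ∼S-refl , vx))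

  N⁻G⊆¬¬N⁻Q : ∀ v {x} → N⁻G v x → ¬ ¬ N⁻Q v x
  N⁻G⊆¬¬N⁻Q v (inj₂ refl) ∉ = ∉ (inj₂ ∼S-refl)
  N⁻G⊆¬¬N⁻Q v {x} (inj₁ xv) ∉ =
    ∉ (inj₁ ((λ x∼v → ∉ (inj₂ x∼v)) , x , v , ∼S-refl , ∼S-refl , xv))

  N⁺G? : ∀ v → Decidable (N⁺G v)
  N⁺G? v x = (adj v x ≟ᵇ _) ⊎-dec (x ≟ v)

  N⁻G? : ∀ v → Decidable (N⁻G v)
  N⁻G? v x = (adj x v ≟ᵇ _) ⊎-dec (x ≟ v)

lemma4 : (G : Digraph) → QuotientThin G
lemma4 G a b a≁b (N⁺Q≐ , N⁻Q≐) =
  a≁b ( ≐-reflect (N⁺Q⊆N⁺G G) (N⁺G⊆¬¬N⁺Q G) (N⁺G? G) N⁺Q≐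
      , ≐-reflect (N⁻Q⊆N⁻G G) (N⁻G⊆¬¬N⁻Q G) (N⁻G? G) N⁻Q≐ )
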